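{- For a positive integer $m$, let $\mathcal{P}_m$ be the set of partitions whose largest part is exactly $m$. Then for every positive integer $k$, \[ \sum_{\lambda\in\mathcal{P}_{2k}}x^{\mathrm{pi}(\lambda)}q^{|\lambda|}=q^{2k}\sum_{0\le j\le k}\frac{x^{2j}q^{\binom{2j}{2}}}{(q;q)_{2j}(q^2;q^2)_{k-j}},\qquad \sum_{\lambda\in\mathcal{P}_{2k-1}}x^{\mathrm{pi}(\lambda)}q^{|\lambda|}=q^{2k-1}\sum_{1\le j\le k}\frac{x^{2j-1}q^{\binom{2j-1}{2}}}{(q;q)_{2j-1}(q^2;q^2)_{k-j}}. \]
   Context: For a partition $\lambda=(\lambda_1\ge\cdots\ge\lambda_l)$, $|\lambda|$ is the sum of its parts and the parity index $\mathrm{pi}(\lambda)$ is the number of parity changes in the sequence $0,\lambda_l,\lambda_{l-1},\dots,\lambda_1$ read left to right, i.e. the number of $i\in\{1,\dots,l\}$ with $\lambda_i-\lambda_{i+1}$ odd, where $\lambda_{l+1}=0$. $(a;q)_0=1$, $(a;q)_n=(1-a)(1-aq)\cdots(1-aq^{n-1})$. The identities are of formal power series in $q$ (or for $|q|<1$). -}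

module Defs where

open import Data.Nat using (ℕ; zero; suc; _+_; _*_; _∸_; _≤_; _≥_; _<_; _≟_; _%_)
open import Data.Nat.Combinatorics using (_C_)
open import Data.List using (List; []; _∷_; map; upTo; foldr)
open import Data.Nat.ListAction using (sum)
open import Data.List.Relation.Unary.All using (All)
open import Data.List.Relation.Unary.Linked using (Linked)
open import Relation.Nullary.Decidable using (⌊_⌋)
open import Data.Bool using (if_then_else_)

record Partition : Set where
  constructor mkPartition
  field
    parts      : List ℕ
    decreasing : Linked _≥_ parts
    positive   : All (λ a → 0 < a) parts
open Partition public

size : Partition → ℕ
size l = sum (parts l)

largestList : List ℕ → ℕ
largestList []      = 0
largestList (a ∷ _) = a

largest : Partition → ℕ
largest l = largestList (parts l)

piList : List ℕ → ℕ
piList []            = 0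
piList (a ∷ [])      = (a ∸ 0) % 2
piList (a ∷ b ∷ r)   = (a ∸ b) % 2 + piList (b ∷ r)

pi : Partition → ℕ
pi l = piList (parts l)

-- Formal power series in q with polynomial coefficients in x, over ℕ.
-- A series F is given by its coefficients: F n p = [q^n x^p] F.

Series : Set
Series = ℕ → ℕ → ℕ

sumTo : ℕ → (ℕ → ℕ) → ℕ
sumTo zero    f = f 0
sumTo (suc n) f = sumTo n f + f (suc n)

oneS : Series
oneS n p = if ⌊ n ≟ 0 ⌋ then (if ⌊ p ≟ 0 ⌋ then 1 else 0) else 0

zeroS : Series
zeroS _ _ = 0

_⊕_ : Series → Series → Series
(f ⊕ g) n p = f n p + g n p

_⊛_ : Series → Series → Series
(f ⊛ g) n p = sumTo n (λ i → sumTo p (λ j → f i j * g (n ∸ i) (p ∸ j)))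

mono : ℕ → ℕ → Series
mono a b n p = if ⌊ n ≟ b ⌋ then (if ⌊ p ≟ a ⌋ then 1 else 0) else 0

-- 1/(1 - q^e) = Σ_{t≥0} q^{e t}   (used only with e ≥ 1):
-- coefficient of q^n x^p = #{ t ≤ n | e t = n } if p = 0, else 0
geo : ℕ → Series
geo e n p = if ⌊ p ≟ 0 ⌋
              then sumTo n (λ t → if ⌊ e * t ≟ n ⌋ then 1 else 0)
              else 0

-- 1/(q^a;q^a)_m = Π_{t=1}^{m} 1/(1 - q^{a t})
recipPoch : ℕ → ℕ → Series
recipPoch a zero    = oneS
recipPoch a (suc m) = recipPoch a m ⊛ geo (a * suc m)

sumS : List ℕ → (ℕ → Series) → Series
sumS js F = foldr (λ j acc → F j ⊕ acc) zeroS js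

range : ℕ → ℕ → List ℕ
range a b = map (a +_) (upTo (suc b ∸ a))

rhsEven : ℕ → Series
rhsEven k = mono 0 (2 * k) ⊛
  sumS (range 0 k) (λ j →
    (mono (2 * j) ((2 * j) C 2) ⊛ recipPoch 1 (2 * j)) ⊛ recipPoch 2 (k ∸ j))

rhsOdd : ℕ → Series
rhsOdd k = mono 0 (2 * k ∸ 1) ⊛
  sumS (range 1 k) (λ j →
    (mono (2 * j ∸ 1) ((2 * j ∸ 1) C 2) ⊛ recipPoch 1 (2 * j ∸ 1)) ⊛ recipPoch 2 (k ∸ j))

-- Split every difference λᵢ − λᵢ₊₁ (with λ_{l+1} = 0) of a partition λ into its parity and
-- twice its half.  This writes λ = ρ + 2σ, where every difference of ρ is 0 or 1 and σ is an
-- arbitrary partition, so that pi(λ) = ρ₁ = r and λ₁ = r + 2s with s = σ₁.  Recording how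
-- often ρ takes each value 1, …, r and σ each value 1, …, s (beyond the compulsory once for
-- every value of ρ and for the top value of σ) gives lists c, e of lengths r, s with
-- |λ| = λ₁ + C(r,2) + Σ v c_v + 2 Σ u e_u.  The partitions with λ₁ = r + 2s and pi(λ) = r are
-- therefore counted by x^r q^{r+2s+C(r,2)} / ((q;q)_r (q²;q²)_s), and r + 2s = 2k (resp.
-- 2k − 1) forces r = 2j (resp. 2j − 1) and s = k − j.

{-# OPTIONS --safe #-}
module Submission where

open import Defs
open import Data.Bool using (if_then_else_)
open import Data.Empty using (⊥-elim)
open import Data.Fin using (Fin)
open import Data.Fin.Properties using (+↔⊎; *↔×)
open import Data.List using (List; []; _∷_; length; map; applyUpTo)
open import Data.List.Relation.Unary.All as All using (All; _∷_)
open import Data.List.Relation.Unary.Linked as Linked using (Linked; []; [-]; _∷_)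
open import Data.Nat using (ℕ; zero; suc; _+_; _*_; _∸_; _≤_; _≥_; _<_; z≤n; s≤s; _≟_; _%_; NonZero)
open import Data.Nat.Combinatorics using (_C_; nC1≡n; nCk+nC[k+1]≡[n+1]C[k+1])
open import Data.Nat.ListAction using (sum)
open import Data.Nat.Properties
open import Data.Nat.Solver using (module +-*-Solver)
open import Data.Product using (Σ; _×_; _,_; proj₁; proj₂; map₁; map₂)
open import Data.Product.Function.Dependent.Propositional using (Σ-↔)
open import Data.Product.Function.NonDependent.Propositional using (_×-↔_)
open import Data.Sum using (_⊎_; inj₁; inj₂)
open import Data.Sum.Function.Propositional using (_⊎-↔_)
open import Data.Unit using (⊤; tt)
open import Function using (_∘_; id)
open import Function.Bundles using (_↔_; mk↔ₛ′; Inverse)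
open import Function.Properties.Inverse using (↔-refl; ↔-sym; ↔-trans)
import Function.Related.Propositional as Related
open import Relation.Nullary using (¬_; Dec; yes; no; Irrelevant)
open import Relation.Nullary.Decidable using (⌊_⌋)
open import Relation.Binary.PropositionalEquality

open Inverse using (to)

-- Bijections onto Fin

×-irrelevant : ∀ {A B : Set} → Irrelevant A → Irrelevant B → Irrelevant (A × B)
×-irrelevant irrA irrB (a , b) (a′ , b′) = cong₂ _,_ (irrA a a′) (irrB b b′)

prop↔ : ∀ {A B : Set} → Irrelevant A → Irrelevant B → (A → B) → (B → A) → A ↔ B
prop↔ irrA irrB f g = mk↔ₛ′ f g (λ b → irrB _ b) (λ a → irrA _ a)

empty↔Fin0 : ∀ {A : Set} → ¬ A → A ↔ Fin 0
empty↔Fin0 ¬a = mk↔ₛ′ (λ a → ⊥-elim (¬a a)) (λ ()) (λ ()) (λ a → ⊥-elim (¬a a))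

Fin-dec↔ : ∀ {P : Set} (P? : Dec P) → Irrelevant P → Fin (if ⌊ P? ⌋ then 1 else 0) ↔ P
Fin-dec↔ (yes p) irr = mk↔ₛ′ (λ _ → p) (λ _ → Fin.zero) (irr p) (λ { Fin.zero → refl ; (Fin.suc ()) })
Fin-dec↔ (no ¬p) irr = ↔-sym (empty↔Fin0 ¬p)

sumTo-suc : ∀ n (h : ℕ → ℕ) → sumTo (suc n) h ≡ h 0 + sumTo n (h ∘ suc)
sumTo-suc zero    h = refl
sumTo-suc (suc n) h = trans (cong (_+ h (2 + n)) (sumTo-suc n h)) (+-assoc (h 0) _ _)

sumS-applyUpTo : ∀ k (f g : ℕ → ℕ) (F : ℕ → Series) n p →
  sumS (map f (applyUpTo g (suc k))) F n p ≡ sumTo k (λ i → F (f (g i)) n p)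
sumS-applyUpTo zero    f g F n p = +-identityʳ _
sumS-applyUpTo (suc k) f g F n p =
  trans (cong (F (f (g 0)) n p +_) (sumS-applyUpTo k f (g ∘ suc) F n p)) (sym (sumTo-suc k _))

Σ≤zero↔ : ∀ {P : ℕ → Set} → Σ ℕ (λ i → i ≤ 0 × P i) ↔ P 0
Σ≤zero↔ = mk↔ₛ′ (λ { (zero , z≤n , x) → x }) (λ x → 0 , z≤n , x)
  (λ _ → refl) (λ { (zero , z≤n , x) → refl })

Σ≤suc↔ : ∀ {n} {P : ℕ → Set} →
  Σ ℕ (λ i → i ≤ suc n × P i) ↔ (P 0 ⊎ Σ ℕ (λ i → i ≤ n × P (suc i)))
Σ≤suc↔ = mk↔ₛ′
  (λ { (zero , z≤n , x) → inj₁ x ; (suc i , s≤s i≤n , x) → inj₂ (i , i≤n , x) })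
  (λ { (inj₁ x) → 0 , z≤n , x ; (inj₂ (i , i≤n , x)) → suc i , s≤s i≤n , x })
  (λ { (inj₁ x) → refl ; (inj₂ (i , i≤n , x)) → refl })
  (λ { (zero , z≤n , x) → refl ; (suc i , s≤s i≤n , x) → refl })

Σ≤↔Fin-sumTo : ∀ n {P : ℕ → Set} {h : ℕ → ℕ} → (∀ i → P i ↔ Fin (h i)) →
  Σ ℕ (λ i → i ≤ n × P i) ↔ Fin (sumTo n h)
Σ≤↔Fin-sumTo zero    P↔ = ↔-trans Σ≤zero↔ (P↔ 0)
Σ≤↔Fin-sumTo (suc n) {P} {h} P↔ = begin
  Σ ℕ (λ i → i ≤ suc n × P i)             ↔⟨ Σ≤suc↔ ⟩
  (P 0 ⊎ Σ ℕ (λ i → i ≤ n × P (suc i)))   ↔⟨ P↔ 0 ⊎-↔ Σ≤↔Fin-sumTo n (P↔ ∘ suc) ⟩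
  (Fin (h 0) ⊎ Fin (sumTo n (h ∘ suc)))   ↔⟨ +↔⊎ ⟨
  Fin (h 0 + sumTo n (h ∘ suc))           ≡⟨ cong Fin (sumTo-suc n h) ⟨
  Fin (sumTo (suc n) h)                   ∎
  where open Related.EquationalReasoning

+≡↔≤×∸≡ : ∀ {m n k} → (m + n ≡ k) ↔ (m ≤ k × n ≡ k ∸ m)
+≡↔≤×∸≡ {m} {n} = prop↔ ≡-irrelevant (×-irrelevant ≤-irrelevant ≡-irrelevant)
  (λ { refl → m≤m+n m n , sym (m+n∸m≡n m n) })
  (λ { (m≤k , refl) → m+[n∸m]≡n m≤k })

-- Weighted sets and their generating functions

record WeightedSet : Set₁ where
  constructor weighted
  field
    Elem : Set
    qdeg : Elem → ℕ
    xdeg : Elem → ℕ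
open WeightedSet

Fibre : WeightedSet → ℕ → ℕ → Set
Fibre A n p = Σ (Elem A) (λ a → qdeg A a ≡ n × xdeg A a ≡ p)

infix 4 _hasGF_ _≅_

_hasGF_ : WeightedSet → Series → Set
A hasGF F = ∀ n p → Fibre A n p ↔ Fin (F n p)

hasGF-cong : ∀ {A F G} → (∀ n p → F n p ≡ G n p) → A hasGF F → A hasGF G
hasGF-cong F≗G gf n p rewrite sym (F≗G n p) = gf n p

record _≅_ (A B : WeightedSet) : Set where
  field
    elems   : Elem A ↔ Elem B
    qdeg-to : ∀ a → qdeg B (to elems a) ≡ qdeg A a
    xdeg-to : ∀ a → xdeg B (to elems a) ≡ xdeg A a
open _≅_

≅-sym : ∀ {A B} → A ≅ B → B ≅ A
≅-sym {A} {B} A≅B = record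
  { elems   = ↔-sym (elems A≅B)
  ; qdeg-to = λ b → trans (sym (qdeg-to A≅B _)) (cong (qdeg B) (to∘from b))
  ; xdeg-to = λ b → trans (sym (xdeg-to A≅B _)) (cong (xdeg B) (to∘from b))
  }
  where to∘from = Inverse.strictlyInverseˡ (elems A≅B)

≅-hasGF : ∀ {A B F} → A ≅ B → A hasGF F → B hasGF F
≅-hasGF {A} {B} A≅B gf n p = ↔-trans (↔-sym (Σ-↔ (elems A≅B) degrees)) (gf n p)
  where
  degrees : ∀ {a} → (qdeg A a ≡ n × xdeg A a ≡ p) ↔
                    (qdeg B (to (elems A≅B) a) ≡ n × xdeg B (to (elems A≅B) a) ≡ p)
  degrees {a} rewrite qdeg-to A≅B a | xdeg-to A≅B a = ↔-refl

point : ℕ → ℕ → WeightedSet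
point a b = weighted ⊤ (λ _ → b) (λ _ → a)

point-hasGF : ∀ a b → point a b hasGF mono a b
point-hasGF a b n p with n ≟ b | p ≟ a
... | yes refl | yes refl = mk↔ₛ′ (λ _ → Fin.zero) (λ _ → tt , refl , refl)
                              (λ { Fin.zero → refl ; (Fin.suc ()) }) (λ { (tt , refl , refl) → refl })
... | yes _    | no p≢a   = empty↔Fin0 (λ (_ , _ , a≡p) → p≢a (sym a≡p))
... | no n≢b   | _        = empty↔Fin0 (λ (_ , b≡n , _) → n≢b (sym b≡n))

multiples : ℕ → WeightedSet
multiples e = weighted ℕ (e *_) (λ _ → 0)

multiples-hasGF : ∀ e .{{_ : NonZero e}} → multiples e hasGF geo e
multiples-hasGF e n p with p ≟ 0
... | no p≢0   = empty↔Fin0 (λ (_ , _ , 0≡p) → p≢0 (sym 0≡p))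
... | yes refl = ↔-trans bounded (Σ≤↔Fin-sumTo n (λ t → ↔-sym (Fin-dec↔ (e * t ≟ n) ≡-irrelevant)))
  where
  bounded : Fibre (multiples e) n 0 ↔ Σ ℕ (λ t → t ≤ n × e * t ≡ n)
  bounded = mk↔ₛ′ (λ (t , et≡n , _) → t , subst (t ≤_) et≡n (m≤n*m t e) , et≡n)
                  (λ (t , _ , et≡n) → t , et≡n , refl)
                  (λ (t , t≤n , et≡n) → cong (λ t≤n → t , t≤n , et≡n) (≤-irrelevant _ _))
                  (λ { (t , et≡n , refl) → refl })

infixr 7 _⊗_

_⊗_ : WeightedSet → WeightedSet → WeightedSet
A ⊗ B = weighted (Elem A × Elem B)
  (λ (a , b) → qdeg A a + qdeg B b) (λ (a , b) → xdeg A a + xdeg B b)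

fibre-⊗↔ : ∀ A B n p → Fibre (A ⊗ B) n p ↔
  Σ ℕ (λ i → i ≤ n × Σ ℕ (λ j → j ≤ p × (Fibre A i j × Fibre B (n ∸ i) (p ∸ j))))
fibre-⊗↔ A B n p = ↔-trans (Σ-↔ ↔-refl (+≡↔≤×∸≡ ×-↔ +≡↔≤×∸≡)) regroup
  where
  regroup : Σ (Elem A × Elem B) (λ (a , b) → (qdeg A a ≤ n × qdeg B b ≡ n ∸ qdeg A a)
                                            × (xdeg A a ≤ p × xdeg B b ≡ p ∸ xdeg A a)) ↔
            Σ ℕ (λ i → i ≤ n × Σ ℕ (λ j → j ≤ p × (Fibre A i j × Fibre B (n ∸ i) (p ∸ j))))
  regroup = mk↔ₛ′
    (λ { ((a , b) , (i≤n , qb) , (j≤p , xb)) →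
           qdeg A a , i≤n , xdeg A a , j≤p , (a , refl , refl) , (b , qb , xb) })
    (λ { (_ , i≤n , _ , j≤p , (a , refl , refl) , (b , qb , xb)) → (a , b) , (i≤n , qb) , (j≤p , xb) })
    (λ { (_ , _ , _ , _ , (_ , refl , refl) , _) → refl })
    (λ { ((a , b) , _) → refl })

⊗-hasGF : ∀ {A B F G} → A hasGF F → B hasGF G → (A ⊗ B) hasGF (F ⊛ G)
⊗-hasGF {A} {B} gfA gfB n p = ↔-trans (fibre-⊗↔ A B n p)
  (Σ≤↔Fin-sumTo n λ i → Σ≤↔Fin-sumTo p λ j →
     ↔-trans (gfA i j ×-↔ gfB (n ∸ i) (p ∸ j)) (↔-sym *↔×))

shift : ℕ → ℕ → WeightedSet → WeightedSet
shift a b A = weighted (Elem A) (λ x → b + qdeg A x) (λ x → a + xdeg A x)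

shift-hasGF : ∀ {a b A F} → A hasGF F → shift a b A hasGF (mono a b ⊛ F)
shift-hasGF {a} {b} {A} gf = ≅-hasGF point⊗A≅shift (⊗-hasGF (point-hasGF a b) gf)
  where
  point⊗A≅shift : point a b ⊗ A ≅ shift a b A
  point⊗A≅shift = record
    { elems   = mk↔ₛ′ proj₂ (tt ,_) (λ _ → refl) (λ _ → refl)
    ; qdeg-to = λ _ → refl
    ; xdeg-to = λ _ → refl
    }

⋃≤ : ℕ → (ℕ → WeightedSet) → WeightedSet
⋃≤ m A = weighted (Σ ℕ (λ i → i ≤ m × Elem (A i)))
  (λ (i , _ , a) → qdeg (A i) a) (λ (i , _ , a) → xdeg (A i) a)

⋃≤-hasGF : ∀ {m} {A : ℕ → WeightedSet} {F : ℕ → Series} →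
  (∀ i → A i hasGF F i) → ⋃≤ m A hasGF (λ n p → sumTo m (λ i → F i n p))
⋃≤-hasGF {m} {A} gf n p = ↔-trans regroup (Σ≤↔Fin-sumTo m (λ i → gf i n p))
  where
  regroup : Fibre (⋃≤ m A) n p ↔ Σ ℕ (λ i → i ≤ m × Fibre (A i) n p)
  regroup = mk↔ₛ′ (λ ((i , i≤m , a) , degs) → i , i≤m , a , degs)
                  (λ (i , i≤m , a , degs) → (i , i≤m , a) , degs)
                  (λ _ → refl) (λ _ → refl)

-- weight [c_m, …, c_1] is the size of the partition having c_v parts equal to v.
weight : List ℕ → ℕ
weight []       = 0
weight (c ∷ cs) = suc (length cs) * c + weight cs

ListOfLength : ℕ → Set
ListOfLength m = Σ (List ℕ) (λ c → length c ≡ m)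

tuples : ℕ → ℕ → WeightedSet
tuples a m = weighted (ListOfLength m) (λ (c , _) → a * weight c) (λ _ → 0)

tuples-hasGF : ∀ a .{{_ : NonZero a}} m → tuples a m hasGF recipPoch a m
tuples-hasGF a zero    = ≅-hasGF point≅tuples (point-hasGF 0 0)
  where
  point≅tuples : point 0 0 ≅ tuples a 0
  point≅tuples = record
    { elems   = mk↔ₛ′ (λ _ → [] , refl) (λ _ → tt) (λ { ([] , refl) → refl }) (λ _ → refl)
    ; qdeg-to = λ _ → *-zeroʳ a
    ; xdeg-to = λ _ → refl
    }
tuples-hasGF a (suc m) = ≅-hasGF tuples⊗multiples≅tuples
  (⊗-hasGF (tuples-hasGF a m) (multiples-hasGF (a * suc m) {{m*n≢0 a (suc m)}}))
  where
  open +-*-Solver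
  tuples⊗multiples≅tuples : tuples a m ⊗ multiples (a * suc m) ≅ tuples a (suc m)
  tuples⊗multiples≅tuples = record
    { elems   = mk↔ₛ′ (λ ((c , ∣c∣≡m) , t) → t ∷ c , cong suc ∣c∣≡m)
                  (λ { (t ∷ c , ∣c∣≡1+m) → (c , suc-injective ∣c∣≡1+m) , t })
                  (λ { (t ∷ c , _) → cong (t ∷ c ,_) (≡-irrelevant _ _) })
                  (λ ((c , _) , t) → cong (λ eq → (c , eq) , t) (≡-irrelevant _ _))
    ; qdeg-to = λ ((c , ∣c∣≡m) , t) → trans (cong (λ l → a * (suc l * t + weight c)) ∣c∣≡m)
                  (solve 4 (λ a l w t → a :* ((con 1 :+ l) :* t :+ w) := a :* w :+ a :* (con 1 :+ l) :* t)
                     refl a m (weight c) t)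
    ; xdeg-to = λ _ → refl
    }

-- Codes of partitions

-- (c , e) encodes λ = ρ + 2σ: with c = [c_r, …, c_1] and e = [e_s, …, e_1], ρ takes the
-- value v exactly 1 + c_v times, and σ takes the value u exactly e_u times, except for its
-- largest value s, which it takes 1 + e_s times.
Code : Set
Code = List ℕ × List ℕ

codeLargest : Code → ℕ
codeLargest (c , e) = length c + 2 * length e

codePi : Code → ℕ
codePi (c , e) = length c

belowTopSize : Code → ℕ
belowTopSize (c , e) = length c C 2 + weight c + 2 * weight e

codeSize : Code → ℕ
codeSize x = codeLargest x + belowTopSize x

bump : List ℕ → List ℕ
bump []       = []
bump (a ∷ as) = suc a ∷ as

-- push d x puts on top of the partition encoded by x a new largest part, exceeding the old
-- one by d.
push : ℕ → Code → Code
push zero          (c , e) = bump c , bump e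
push (suc zero)    (c , e) = 0 ∷ c , bump e
push (suc (suc d)) x       = map₂ (0 ∷_) (push d x)

popParity : List ℕ → List ℕ → ℕ × Code
popParity []          e = 0 , [] , e
popParity (zero ∷ c)  e = 1 , c , e
popParity (suc a ∷ c) e = 0 , a ∷ c , e

pop : Code → ℕ × Code
pop (c , zero ∷ e)  = map₁ (2 +_) (pop (c , e))
pop (c , [])        = popParity c []
pop (c , suc a ∷ e) = popParity c (a ∷ e)

rest : Code → Code
rest = proj₂ ∘ pop

pop-bump : ∀ c e → pop (c , bump e) ≡ popParity c e
pop-bump c []      = refl
pop-bump c (a ∷ e) = refl

popParity-bump : ∀ c e → popParity (bump c) e ≡ (0 , c , e)
popParity-bump []      e = refl
popParity-bump (a ∷ c) e = refl

pop-push : ∀ d x → pop (push d x) ≡ (d , x)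
pop-push zero          (c , e) = trans (pop-bump (bump c) e) (popParity-bump c e)
pop-push (suc zero)    (c , e) = pop-bump (0 ∷ c) e
pop-push (suc (suc d)) x       = cong (map₁ (2 +_)) (pop-push d x)

push-popParity : ∀ c e → push (proj₁ (popParity c e)) (proj₂ (popParity c e)) ≡ (c , bump e)
push-popParity []          e = refl
push-popParity (zero ∷ c)  e = refl
push-popParity (suc a ∷ c) e = refl

push-pop : ∀ x → push (proj₁ (pop x)) (rest x) ≡ x
push-pop (c , zero ∷ e)  = cong (map₂ (0 ∷_)) (push-pop (c , e))
push-pop (c , [])        = push-popParity c []
push-pop (c , suc a ∷ e) = push-popParity c (a ∷ e)

length-bump : ∀ l → length (bump l) ≡ length l
length-bump []      = refl
length-bump (a ∷ l) = refl

weight-bump : ∀ l → weight (bump l) ≡ length l + weight l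
weight-bump []      = refl
weight-bump (a ∷ l) =
  trans (cong (_+ weight l) (*-suc (suc (length l)) a)) (+-assoc (suc (length l)) _ (weight l))

suc-C2 : ∀ n → suc n C 2 ≡ n + n C 2
suc-C2 n = trans (sym (nCk+nC[k+1]≡[n+1]C[k+1] n 1)) (cong (_+ n C 2) (nC1≡n n))

+-2*suc : ∀ a b → a + 2 * suc b ≡ 2 + (a + 2 * b)
+-2*suc = solve 2 (λ a b → a :+ con 2 :* (con 1 :+ b) := con 2 :+ (a :+ con 2 :* b)) refl
  where open +-*-Solver

codeLargest-push : ∀ d x → codeLargest (push d x) ≡ d + codeLargest x
codeLargest-push zero          (c , e) = cong₂ (λ a b → a + 2 * b) (length-bump c) (length-bump e)
codeLargest-push (suc zero)    (c , e) = cong (λ b → suc (length c + 2 * b)) (length-bump e)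
codeLargest-push (suc (suc d)) x       =
  trans (+-2*suc (length (proj₁ (push d x))) _) (cong (2 +_) (codeLargest-push d x))

belowTopSize-0∷ : ∀ c e → belowTopSize (c , 0 ∷ e) ≡ belowTopSize (c , e)
belowTopSize-0∷ c e =
  cong (λ w → length c C 2 + weight c + 2 * (w + weight e)) (*-zeroʳ (suc (length e)))

belowTopSize-push : ∀ d x → belowTopSize (push d x) ≡ codeSize x
belowTopSize-push zero (c , e)
  rewrite length-bump c | weight-bump c | weight-bump e =
  solve 5 (λ r s k w v → k :+ (r :+ w) :+ con 2 :* (s :+ v) := r :+ con 2 :* s :+ (k :+ w :+ con 2 :* v))
    refl (length c) (length e) (length c C 2) (weight c) (weight e)
  where open +-*-Solver
belowTopSize-push (suc zero) (c , e)
  rewrite suc-C2 (length c) | *-zeroʳ (suc (length c)) | weight-bump e =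
  solve 5 (λ r s k w v → r :+ k :+ w :+ con 2 :* (s :+ v) := r :+ con 2 :* s :+ (k :+ w :+ con 2 :* v))
    refl (length c) (length e) (length c C 2) (weight c) (weight e)
  where open +-*-Solver
belowTopSize-push (suc (suc d)) x =
  trans (belowTopSize-0∷ (proj₁ (push d x)) (proj₂ (push d x))) (belowTopSize-push d x)

codePi-push : ∀ d x → codePi (push d x) ≡ d % 2 + codePi x
codePi-push zero          (c , e) = length-bump c
codePi-push (suc zero)    (c , e) = refl
codePi-push (suc (suc d)) x       = codePi-push d x

codeLargest-pop : ∀ x → codeLargest x ≡ proj₁ (pop x) + codeLargest (rest x)
codeLargest-pop x =
  trans (cong codeLargest (sym (push-pop x))) (codeLargest-push (proj₁ (pop x)) (rest x))

rest-≤ : ∀ x → codeLargest (rest x) ≤ codeLargest x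
rest-≤ x = subst (codeLargest (rest x) ≤_) (sym (codeLargest-pop x)) (m≤n+m _ (proj₁ (pop x)))

belowTopSize-pop : ∀ x → belowTopSize x ≡ codeSize (rest x)
belowTopSize-pop x =
  trans (cong belowTopSize (sym (push-pop x))) (belowTopSize-push (proj₁ (pop x)) (rest x))

codeLargest≡0 : ∀ {x} → codeLargest x ≡ 0 → x ≡ ([] , [])
codeLargest≡0 {[] , []} _ = refl

decode : List ℕ → Code
decode []      = [] , []
decode (a ∷ l) = push (a ∸ largestList l) (decode l)

largestList-≤ : ∀ {a l} → Linked _≥_ (a ∷ l) → largestList l ≤ a
largestList-≤ [-]       = z≤n
largestList-≤ (b≤a ∷ _) = b≤a

linked-∷ : ∀ {a l} → largestList l ≤ a → Linked _≥_ l → Linked _≥_ (a ∷ l)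
linked-∷ {l = []}    _   _  = [-]
linked-∷ {l = _ ∷ _} b≤a lk = b≤a ∷ lk

piList-∷ : ∀ a l → piList (a ∷ l) ≡ (a ∸ largestList l) % 2 + piList l
piList-∷ a []      = sym (+-identityʳ _)
piList-∷ a (b ∷ l) = refl

decode-largest : ∀ {l} → Linked _≥_ l → codeLargest (decode l) ≡ largestList l
decode-largest {[]}    _  = refl
decode-largest {a ∷ l} lk = begin
  codeLargest (push (a ∸ largestList l) (decode l))
    ≡⟨ codeLargest-push (a ∸ largestList l) (decode l) ⟩
  a ∸ largestList l + codeLargest (decode l)
    ≡⟨ cong (a ∸ largestList l +_) (decode-largest (Linked.tail lk)) ⟩
  a ∸ largestList l + largestList l
    ≡⟨ m∸n+n≡m (largestList-≤ lk) ⟩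
  a ∎
  where open ≡-Reasoning

decode-size : ∀ {l} → Linked _≥_ l → codeSize (decode l) ≡ sum l
decode-size {[]}    _  = refl
decode-size {a ∷ l} lk = cong₂ _+_ (decode-largest lk)
  (trans (belowTopSize-push (a ∸ largestList l) (decode l)) (decode-size (Linked.tail lk)))

decode-pi : ∀ l → codePi (decode l) ≡ piList l
decode-pi []      = refl
decode-pi (a ∷ l) = trans (codePi-push (a ∸ largestList l) (decode l))
  (trans (cong ((a ∸ largestList l) % 2 +_) (decode-pi l)) (sym (piList-∷ a l)))

-- Every emitted part is positive, so codeSize x is enough fuel.
encode : ℕ → Code → List ℕ
encode zero       x = []
encode (suc fuel) x with codeLargest x
... | zero  = []
... | suc a = suc a ∷ encode fuel (rest x)

encode-suc : ∀ fuel {a} x → codeLargest x ≡ suc a → encode (suc fuel) x ≡ suc a ∷ encode fuel (rest x)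
encode-suc fuel x eq with codeLargest x | eq
... | _ | refl = refl

encode-≤ : ∀ fuel x → largestList (encode fuel x) ≤ codeLargest x
encode-≤ zero       x = z≤n
encode-≤ (suc fuel) x with codeLargest x
... | zero  = z≤n
... | suc a = ≤-refl

encode-linked : ∀ fuel x → Linked _≥_ (encode fuel x)
encode-linked zero       x = []
encode-linked (suc fuel) x with codeLargest x in largest≡
... | zero  = []
... | suc a = linked-∷ (≤-trans (encode-≤ fuel (rest x)) (≤-trans (rest-≤ x) (≤-reflexive largest≡)))
                       (encode-linked fuel (rest x))

encode-positive : ∀ fuel x → All (0 <_) (encode fuel x)
encode-positive zero       x = All.[]
encode-positive (suc fuel) x with codeLargest x
... | zero  = All.[]
... | suc a = s≤s z≤n ∷ encode-positive fuel (rest x)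

decode-encode : ∀ fuel x → codeSize x ≤ fuel → decode (encode fuel x) ≡ x
decode-encode zero       x size≤0 = sym (codeLargest≡0 (n≤0⇒n≡0 (≤-trans (m≤m+n _ _) size≤0)))
decode-encode (suc fuel) x size≤  with codeLargest x in largest≡
... | zero  = sym (codeLargest≡0 largest≡)
... | suc a = begin
  push (suc a ∸ largestList (encode fuel (rest x))) (decode (encode fuel (rest x)))
    ≡⟨ cong₂ push (cong (suc a ∸_) top≡) IH ⟩
  push (suc a ∸ codeLargest (rest x)) (rest x)
    ≡⟨ cong (λ d → push d (rest x)) gap≡ ⟩
  push (proj₁ (pop x)) (rest x)
    ≡⟨ push-pop x ⟩
  x ∎
  where
  open ≡-Reasoning
  -- the with-abstraction has turned size≤ into  suc a + belowTopSize x ≤ suc fuel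
  fits : codeSize (rest x) ≤ fuel
  fits = subst (_≤ fuel) (belowTopSize-pop x) (≤-pred (≤-trans (s≤s (m≤n+m _ a)) size≤))
  IH : decode (encode fuel (rest x)) ≡ rest x
  IH = decode-encode fuel (rest x) fits
  top≡ : largestList (encode fuel (rest x)) ≡ codeLargest (rest x)
  top≡ = trans (sym (decode-largest (encode-linked fuel (rest x)))) (cong codeLargest IH)
  gap≡ : suc a ∸ codeLargest (rest x) ≡ proj₁ (pop x)
  gap≡ = trans (cong (_∸ codeLargest (rest x)) (trans (sym largest≡) (codeLargest-pop x)))
               (m+n∸n≡m (proj₁ (pop x)) (codeLargest (rest x)))

encode-decode : ∀ fuel l → Linked _≥_ l → All (0 <_) l → sum l ≤ fuel → encode fuel (decode l) ≡ l
encode-decode zero       []          _  _              _     = refl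
encode-decode (suc fuel) []          _  _              _     = refl
encode-decode zero       (a ∷ l)     _  (0<a ∷ _)      sum≤0 =
  ⊥-elim (<⇒≱ 0<a (≤-trans (m≤m+n a (sum l)) sum≤0))
encode-decode (suc fuel) (suc a ∷ l) lk (_ ∷ positive) (s≤s sum≤) = begin
  encode (suc fuel) (decode (suc a ∷ l))
    ≡⟨ encode-suc fuel (decode (suc a ∷ l)) (decode-largest lk) ⟩
  suc a ∷ encode fuel (rest (push (suc a ∸ largestList l) (decode l)))
    ≡⟨ cong (λ y → suc a ∷ encode fuel (proj₂ y)) (pop-push (suc a ∸ largestList l) (decode l)) ⟩
  suc a ∷ encode fuel (decode l)
    ≡⟨ cong (suc a ∷_) (encode-decode fuel l (Linked.tail lk) positive (≤-trans (m≤n+m _ a) sum≤)) ⟩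
  suc a ∷ l ∎
  where open ≡-Reasoning

partition-≡ : ∀ {μ ν} → parts μ ≡ parts ν → μ ≡ ν
partition-≡ {mkPartition l d p} {mkPartition .l d′ p′} refl =
  cong₂ (mkPartition l) (Linked.irrelevant ≤-irrelevant d d′) (All.irrelevant <-irrelevant p p′)

partition↔code : Partition ↔ Code
partition↔code = mk↔ₛ′ (decode ∘ parts) encodePartition
  (λ x → decode-encode (codeSize x) x ≤-refl)
  (λ μ → partition-≡ (encode-decode _ (parts μ) (decreasing μ) (positive μ)
                        (≤-reflexive (sym (decode-size (decreasing μ))))))
  where
  encodePartition : Code → Partition
  encodePartition x =
    mkPartition (encode (codeSize x) x) (encode-linked (codeSize x) x) (encode-positive (codeSize x) x)

-- Counting codes

codes : ℕ → WeightedSet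
codes m = weighted (Σ Code (λ x → codeLargest x ≡ m)) (codeSize ∘ proj₁) (codePi ∘ proj₁)

summand : ℕ → ℕ → WeightedSet
summand r s = shift r (r C 2) (tuples 1 r) ⊗ tuples 2 s

summandSeries : ℕ → ℕ → Series
summandSeries r s = (mono r (r C 2) ⊛ recipPoch 1 r) ⊛ recipPoch 2 s

summand-hasGF : ∀ r s → summand r s hasGF summandSeries r s
summand-hasGF r s = ⊗-hasGF (shift-hasGF (tuples-hasGF 1 r)) (tuples-hasGF 2 s)

rhsClass : ℕ → ℕ → (ℕ → ℕ) → WeightedSet
rhsClass m k r = shift 0 m (⋃≤ k (λ j → summand (r j) (k ∸ j)))

+-2*-solution : ∀ {o} a b k → o ≤ 1 → a + 2 * b ≡ o + 2 * k → b ≤ k × a ≡ o + 2 * (k ∸ b)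
+-2*-solution     a zero    k       _   eq = z≤n , trans (sym (+-identityʳ a)) eq
+-2*-solution {o} a (suc b) zero    o≤1 eq
  with s≤s () ← ≤-trans (≤-reflexive (trans (sym (+-2*suc a b)) (trans eq (+-identityʳ o)))) o≤1
+-2*-solution {o} a (suc b) (suc k) o≤1 eq = map₁ s≤s (+-2*-solution a b k o≤1
  (suc-injective (suc-injective (trans (sym (+-2*suc a b)) (trans eq (+-2*suc o k))))))

rhsClass≅codes : ∀ {o m k r} → o ≤ 1 → m ≡ o + 2 * k → (∀ j → r j ≡ o + 2 * j) →
  rhsClass m k r ≅ codes m
rhsClass≅codes {o} {m} {k} {r} o≤1 refl r≡ = record
  { elems   = ↔-trans regroup (Σ-↔ ↔-refl λ {x} →
                prop↔ (split-irrelevant x) ≡-irrelevant (split⇒largest x) (largest⇒split x))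
  ; qdeg-to = λ (j , j≤k , (c , ∣c∣≡rj) , (e , ∣e∣≡k-j)) →
                cong₂ _+_ (split⇒largest (c , e) (j , j≤k , ∣c∣≡rj , ∣e∣≡k-j))
                          (cong₂ (λ l w → l C 2 + w + 2 * weight e) ∣c∣≡rj (sym (*-identityˡ (weight c))))
  ; xdeg-to = λ (j , _ , (_ , ∣c∣≡rj) , _) → trans ∣c∣≡rj (sym (trans (+-identityʳ _) (+-identityʳ _)))
  }
  where
  Split : Code → Set
  Split (c , e) = Σ ℕ (λ j → j ≤ k × (length c ≡ r j × length e ≡ k ∸ j))

  regroup : Elem (rhsClass (o + 2 * k) k r) ↔ Σ Code Split
  regroup = mk↔ₛ′ (λ (j , j≤k , (c , ∣c∣) , (e , ∣e∣)) → (c , e) , j , j≤k , ∣c∣ , ∣e∣)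
                  (λ ((c , e) , j , j≤k , ∣c∣ , ∣e∣) → j , j≤k , (c , ∣c∣) , (e , ∣e∣))
                  (λ _ → refl) (λ _ → refl)

  r-injective : ∀ {i j} → r i ≡ r j → i ≡ j
  r-injective {i} {j} ri≡rj =
    *-cancelˡ-≡ i j 2 (+-cancelˡ-≡ o _ _ (trans (sym (r≡ i)) (trans ri≡rj (r≡ j))))

  split-irrelevant : ∀ x → Irrelevant (Split x)
  split-irrelevant (c , e) (i , i≤k , ∣c∣≡ri , _) (j , j≤k , ∣c∣≡rj , _)
    with refl ← r-injective (trans (sym ∣c∣≡ri) ∣c∣≡rj) =
    cong₂ (λ u v → i , u , v) (≤-irrelevant i≤k j≤k) (×-irrelevant ≡-irrelevant ≡-irrelevant _ _)

  split⇒largest : ∀ x → Split x → codeLargest x ≡ o + 2 * k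
  split⇒largest (c , e) (j , j≤k , ∣c∣≡rj , ∣e∣≡k-j) = begin
    length c + 2 * length e   ≡⟨ cong₂ (λ a b → a + 2 * b) (trans ∣c∣≡rj (r≡ j)) ∣e∣≡k-j ⟩
    o + 2 * j + 2 * (k ∸ j)   ≡⟨ +-assoc o _ _ ⟩
    o + (2 * j + 2 * (k ∸ j)) ≡⟨ cong (o +_) (*-distribˡ-+ 2 j (k ∸ j)) ⟨
    o + 2 * (j + (k ∸ j))     ≡⟨ cong (λ l → o + 2 * l) (m+[n∸m]≡n j≤k) ⟩
    o + 2 * k                 ∎
    where open ≡-Reasoning

  largest⇒split : ∀ x → codeLargest x ≡ o + 2 * k → Split x
  largest⇒split (c , e) eq with ∣e∣≤k , ∣c∣≡ ← +-2*-solution (length c) (length e) k o≤1 eq =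
    k ∸ length e , m∸n≤m k (length e) ,
    trans ∣c∣≡ (sym (r≡ (k ∸ length e))) , sym (m∸[m∸n]≡n ∣e∣≤k)

codes-even-hasGF : ∀ k → codes (2 * k) hasGF rhsEven k
codes-even-hasGF k = ≅-hasGF (rhsClass≅codes z≤n refl (λ _ → refl)) (shift-hasGF summands)
  where
  summands : ⋃≤ k (λ j → summand (2 * j) (k ∸ j)) hasGF
             sumS (range 0 k) (λ j → summandSeries (2 * j) (k ∸ j))
  summands = hasGF-cong (λ n p → sym (sumS-applyUpTo k (0 +_) id _ n p))
                        (⋃≤-hasGF (λ j → summand-hasGF (2 * j) (k ∸ j)))

2*suc∸1 : ∀ i → 2 * suc i ∸ 1 ≡ 1 + 2 * i
2*suc∸1 i = +-suc i (i + 0)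

codes-odd-hasGF : ∀ k → codes (2 * suc k ∸ 1) hasGF rhsOdd (suc k)
codes-odd-hasGF k = ≅-hasGF (rhsClass≅codes (s≤s z≤n) (2*suc∸1 k) 2*suc∸1) (shift-hasGF summands)
  where
  summands : ⋃≤ k (λ i → summand (2 * suc i ∸ 1) (k ∸ i)) hasGF
             sumS (range 1 (suc k)) (λ j → summandSeries (2 * j ∸ 1) (suc k ∸ j))
  summands = hasGF-cong (λ n p → sym (sumS-applyUpTo k (1 +_) id _ n p))
                        (⋃≤-hasGF (λ i → summand-hasGF (2 * suc i ∸ 1) (k ∸ i)))

partitions : ℕ → WeightedSet
partitions m = weighted (Σ Partition (λ μ → largest μ ≡ m)) (size ∘ proj₁) (pi ∘ proj₁)

partitions≅codes : ∀ m → partitions m ≅ codes m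
partitions≅codes m = record
  { elems   = Σ-↔ partition↔code λ {μ} → largest≡ μ
  ; qdeg-to = λ (μ , _) → decode-size (decreasing μ)
  ; xdeg-to = λ (μ , _) → decode-pi (parts μ)
  }
  where
  largest≡ : ∀ μ → (largest μ ≡ m) ↔ (codeLargest (decode (parts μ)) ≡ m)
  largest≡ μ rewrite decode-largest (decreasing μ) = ↔-refl

fibre-partitions↔ : ∀ {m n p} →
  Σ Partition (λ μ → size μ ≡ n × largest μ ≡ m × pi μ ≡ p) ↔ Fibre (partitions m) n p
fibre-partitions↔ = mk↔ₛ′ (λ (μ , s , l , π) → (μ , l) , s , π)
                          (λ ((μ , l) , s , π) → μ , s , l , π)
                          (λ _ → refl) (λ _ → refl)

mainTheorem5 : (k : ℕ) → 1 ≤ k →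
    ((n p : ℕ) →
    (Σ Partition (λ l → size l ≡ n × largest l ≡ 2 * k × pi l ≡ p))
    ↔ Fin (rhsEven k n p))
    ×
    ((n p : ℕ) →
    (Σ Partition (λ l → size l ≡ n × largest l ≡ 2 * k ∸ 1 × pi l ≡ p))
    ↔ Fin (rhsOdd k n p))
mainTheorem5 (suc k) _ = count (codes-even-hasGF (suc k)) , count (codes-odd-hasGF k)
  where
  count : ∀ {m F} → codes m hasGF F → ∀ n p →
    Σ Partition (λ μ → size μ ≡ n × largest μ ≡ m × pi μ ≡ p) ↔ Fin (F n p)
  count gf n p = ↔-trans fibre-partitions↔ (≅-hasGF (≅-sym (partitions≅codes _)) gf n p)
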